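{- Let $\lambda\in\mathbb{R}$, let $\alpha$ be a positive integer and let $m\in\mathbb{N}$ with $m\ge\alpha$. Then \begin{align*} \sum_{k=\alpha}^{m}(k)_{\alpha,\lambda}&=\sum_{k=1}^{m}\binom{m}{k}(k-1)!\Big\{S_{2,\lambda}(\alpha+1,k)+\alpha\lambda\, S_{2,\lambda}(\alpha,k)\Big\}\\ &\quad-\sum_{k=1}^{\alpha-1}\binom{\alpha-1}{k}(k-1)!\Big\{S_{2,\lambda}(\alpha+1,k)+\alpha\lambda\, S_{2,\lambda}(\alpha,k)\Big\}. \end{align*}
   Context: For $\lambda\in\mathbb{R}$, the generalized falling factorial polynomials are $(x)_{0,\lambda}=1$ and $(x)_{n,\lambda}=x(x-\lambda)\cdots(x-(n-1)\lambda)$ for $n\ge1$. The ordinary falling factorial is $(x)_0=1$, $(x)_n=x(x-1)\cdots(x-n+1)$. The degenerate Stirling numbers of the second kind $S_{2,\lambda}(n,k)$ are defined by $(x)_{n,\lambda}=\sum_{k=0}^{n}S_{2,\lambda}(n,k)(x)_{k}$ for all $n\ge 0$, with $S_{2,\lambda}(n,k)=0$ for $k>n$ or $k<0$. -}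

module Defs where

open import Level using (Level)
open import Data.Nat using (ℕ; zero; suc; _∸_) renaming (_+_ to _+ℕ_; _<_ to _<ℕ_)
open import Data.Product using (_×_)
open import Algebra.Bundles using (CommutativeRing)

module RingDefs {c ℓ : Level} (R : CommutativeRing c ℓ) where
  open CommutativeRing R

  ι : ℕ → Carrier
  ι zero    = 0#
  ι (suc n) = 1# + ι n

  genFall : Carrier → Carrier → ℕ → Carrier
  genFall lam x zero    = 1#
  genFall lam x (suc n) = genFall lam x n * (x + - (ι n * lam))

  fall : Carrier → ℕ → Carrier
  fall x zero    = 1#
  fall x (suc n) = fall x n * (x + - ι n)

  sumBelow : ℕ → (ℕ → Carrier) → Carrier
  sumBelow zero    f = 0#
  sumBelow (suc n) f = sumBelow n f + f n

  -- Σ_{k = a}^{b} f k   (empty sum = 0 when b < a)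
  sumFromTo : ℕ → ℕ → (ℕ → Carrier) → Carrier
  sumFromTo a b f = sumBelow (suc b ∸ a) (λ i → f (a +ℕ i))

  -- S is (a choice of) the degenerate Stirling numbers of the second kind for λ:
  -- (x)_{n,λ} = Σ_{k=0}^{n} S n k (x)_k for all n and all x, and S n k = 0 for k > n
  IsDegStirling2 : Carrier → (ℕ → ℕ → Carrier) → Set (c Level.⊔ ℓ)
  IsDegStirling2 lam S =
    ((n : ℕ) (x : Carrier) → genFall lam x n ≈ sumFromTo 0 n (λ k → S n k * fall x k))
    × ((n k : ℕ) → n <ℕ k → S n k ≈ 0#)

{-# OPTIONS --safe #-}

-- Since x (x)_{α,λ} = (x)_{α+1,λ} + αλ (x)_{α,λ}, the Stirling expansions give
-- x (x)_{α,λ} = Σ_k T_k (x)_k, with T_k the braced coefficient of the theorem.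
-- At x = m + 1 every (x)_k with k ≥ 1 is x (m)_{k-1}, and T_0 = 0, so cancelling x
-- yields (m + 1)_{α,λ} = Σ_i (m)_i T_{i+1}.  As (m)_i = (m+1 choose i+1) i! - (m choose i+1) i!,
-- summing over m telescopes to Σ_{j<m} (j + 1)_{α,λ} = Σ_i (m choose i+1) i! T_{i+1};
-- the theorem is the difference of this identity at m and at α - 1.

module Submission where

open import Defs
open import Level using (Level)
open import Data.Nat
  using (ℕ; zero; suc; _∸_; _≤_; _<_; _≤′_; ≤′-refl; ≤′-step; _!; z≤n; s≤s)
  renaming (_+_ to _+ℕ_; _*_ to _*ℕ_)
import Data.Nat.Properties as ℕ
open import Data.Nat.Combinatorics
  using (_C_; nCk≡nC[n∸k]; nCn≡1; k>n⇒nCk≡0; nCk+nC[k+1]≡[n+1]C[k+1])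
open import Data.Product using (proj₁; proj₂)
open import Data.Sum using (inj₁; inj₂)
open import Algebra.Bundles using (CommutativeRing)
import Algebra.Properties.CommutativeSemigroup as CommutativeSemigroupProperties
open import Relation.Binary.PropositionalEquality as ≡ using (_≡_)

nC0≡1 : ∀ n → n C 0 ≡ 1
nC0≡1 n = ≡.trans (nCk≡nC[n∸k] (z≤n {n})) (nCn≡1 n)

[1+n]C[1+k]*x : ∀ n k x → (suc n C suc k) *ℕ x ≡ (n C k) *ℕ x +ℕ (n C suc k) *ℕ x
[1+n]C[1+k]*x n k x = ≡.trans (≡.cong (_*ℕ x) (≡.sym (nCk+nC[k+1]≡[n+1]C[k+1] n k)))
                              (ℕ.*-distribʳ-+ x (n C k) (n C suc k))

module _ {c ℓ : Level} (R : CommutativeRing c ℓ) where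
  open CommutativeRing R hiding (zero)
  open RingDefs R
  open import Relation.Binary.Reasoning.Setoid setoid
  open import Algebra.Properties.Group +-group using (x∙y⁻¹≈ε⇒x≈y; ε⁻¹≈ε)
  open import Algebra.Properties.AbelianGroup +-abelianGroup using (xyx⁻¹≈y; ⁻¹-∙-comm)
  open import Algebra.Properties.Ring ring using (-‿distribʳ-*)
  open CommutativeSemigroupProperties *-commutativeSemigroup using (x∙yz≈y∙zx)
  open CommutativeSemigroupProperties +-commutativeSemigroup using (interchange)
  open import Algebra.Solver.Ring.NaturalCoefficients.Default commutativeSemiring

  ι-homo-+ : ∀ m n → ι (m +ℕ n) ≈ ι m + ι n
  ι-homo-+ zero    n = sym (+-identityˡ _)
  ι-homo-+ (suc m) n = trans (+-congˡ (ι-homo-+ m n)) (sym (+-assoc _ _ _))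

  ι-homo-* : ∀ m n → ι (m *ℕ n) ≈ ι m * ι n
  ι-homo-* zero    n = sym (zeroˡ _)
  ι-homo-* (suc m) n = begin
    ι (n +ℕ m *ℕ n)        ≈⟨ ι-homo-+ n (m *ℕ n) ⟩
    ι n + ι (m *ℕ n)       ≈⟨ +-cong (sym (*-identityˡ _)) (ι-homo-* m n) ⟩
    1# * ι n + ι m * ι n   ≈⟨ distribʳ _ _ _ ⟨
    (1# + ι m) * ι n       ∎

  sumBelow-cong : ∀ {f g} → (∀ i → f i ≈ g i) → ∀ n → sumBelow n f ≈ sumBelow n g
  sumBelow-cong f≈g zero    = refl
  sumBelow-cong f≈g (suc n) = +-cong (sumBelow-cong f≈g n) (f≈g n)

  sumBelow-+ : ∀ f g n → sumBelow n (λ i → f i + g i) ≈ sumBelow n f + sumBelow n g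
  sumBelow-+ f g zero    = sym (+-identityˡ _)
  sumBelow-+ f g (suc n) = trans (+-congʳ (sumBelow-+ f g n)) (interchange _ _ _ _)

  sumBelow-*ˡ : ∀ x f n → sumBelow n (λ i → x * f i) ≈ x * sumBelow n f
  sumBelow-*ˡ x f zero    = sym (zeroʳ _)
  sumBelow-*ˡ x f (suc n) = trans (+-congʳ (sumBelow-*ˡ x f n)) (sym (distribˡ _ _ _))

  sumBelow-suc : ∀ f n → sumBelow (suc n) f ≈ f 0 + sumBelow n (λ i → f (suc i))
  sumBelow-suc f zero    = trans (+-identityˡ _) (sym (+-identityʳ _))
  sumBelow-suc f (suc n) = trans (+-congʳ (sumBelow-suc f n)) (+-assoc _ _ _)

  sumBelow-+ℕ : ∀ f a b → sumBelow (a +ℕ b) f ≈ sumBelow a f + sumBelow b (λ i → f (a +ℕ i))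
  sumBelow-+ℕ f a zero    rewrite ℕ.+-identityʳ a = sym (+-identityʳ _)
  sumBelow-+ℕ f a (suc b) rewrite ℕ.+-suc a b =
    trans (+-congʳ (sumBelow-+ℕ f a b)) (+-assoc _ _ _)

  sumBelow-∸ : ∀ f {a m} → a ≤ m →
    sumBelow (m ∸ a) (λ i → f (a +ℕ i)) ≈ sumBelow m f + - sumBelow a f
  sumBelow-∸ f {a} {m} a≤m = begin
    tail                                 ≈⟨ xyx⁻¹≈y (sumBelow a f) tail ⟨
    sumBelow a f + tail + - sumBelow a f ≈⟨ +-congʳ split ⟨
    sumBelow m f + - sumBelow a f        ∎
    where
    tail = sumBelow (m ∸ a) (λ i → f (a +ℕ i))
    split : sumBelow m f ≈ sumBelow a f + tail
    split = ≡.subst (λ n → sumBelow n f ≈ sumBelow a f + tail)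
                    (ℕ.m+[n∸m]≡n a≤m) (sumBelow-+ℕ f a (m ∸ a))

  sumBelow-vanishing-tail : ∀ {f n N} → (∀ k → n ≤ k → f k ≈ 0#) → n ≤ N →
                            sumBelow N f ≈ sumBelow n f
  sumBelow-vanishing-tail {f} {n} vanish n≤N = go (ℕ.≤⇒≤′ n≤N)
    where
    go : ∀ {N} → n ≤′ N → sumBelow N f ≈ sumBelow n f
    go ≤′-refl            = refl
    go (≤′-step {N} n≤′N) =
      trans (+-cong (go n≤′N) (vanish N (ℕ.≤′⇒≤ n≤′N))) (+-identityʳ _)

  sumBelow-vanishing-beyond : ∀ {f a b} →
    (∀ k → a ≤ k → f k ≈ 0#) → (∀ k → b ≤ k → f k ≈ 0#) → sumBelow a f ≈ sumBelow b f
  sumBelow-vanishing-beyond {a = a} {b} vanishᵃ vanishᵇ with ℕ.≤-total a b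
  ... | inj₁ a≤b = sym (sumBelow-vanishing-tail vanishᵃ a≤b)
  ... | inj₂ b≤a = sumBelow-vanishing-tail vanishᵇ b≤a

  fall-0#-suc : ∀ k → fall 0# (suc k) ≈ 0#
  fall-0#-suc zero    = trans (*-identityˡ _) (trans (+-identityˡ _) ε⁻¹≈ε)
  fall-0#-suc (suc k) = trans (*-congʳ (fall-0#-suc k)) (zeroˡ _)

  fall-1+ : ∀ x k → fall (1# + x) (suc k) ≈ (1# + x) * fall x k
  fall-1+ x zero    = begin
    1# * ((1# + x) + - 0#) ≈⟨ *-identityˡ _ ⟩
    (1# + x) + - 0#        ≈⟨ trans (+-congˡ ε⁻¹≈ε) (+-identityʳ _) ⟩
    1# + x                 ≈⟨ *-identityʳ _ ⟨
    (1# + x) * 1#          ∎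
  fall-1+ x (suc k) = begin
    fall (1# + x) (suc k) * ((1# + x) + - (1# + ι k)) ≈⟨ *-cong (fall-1+ x k) shift ⟩
    ((1# + x) * fall x k) * (x + - ι k)               ≈⟨ *-assoc _ _ _ ⟩
    (1# + x) * (fall x k * (x + - ι k))               ∎
    where
    shift : (1# + x) + - (1# + ι k) ≈ x + - ι k
    shift = begin
      (1# + x) + - (1# + ι k)   ≈⟨ +-congˡ (⁻¹-∙-comm _ _) ⟨
      (1# + x) + (- 1# + - ι k) ≈⟨ interchange _ _ _ _ ⟩
      (1# + - 1#) + (x + - ι k) ≈⟨ trans (+-congʳ (-‿inverseʳ _)) (+-identityˡ _) ⟩
      x + - ι k                 ∎

  fall-pascal : ∀ x k → fall (1# + x) (suc k) ≈ ι (suc k) * fall x k + fall x (suc k)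
  fall-pascal x k = begin
    fall (1# + x) (suc k)            ≈⟨ fall-1+ x k ⟩
    (1# + x) * F                     ≈⟨ +-identityʳ _ ⟨
    (1# + x) * F + 0#                ≈⟨ +-congˡ (trans (*-congˡ (-‿inverseʳ _)) (zeroʳ _)) ⟨
    (1# + x) * F + F * (ι k + - ι k)
      ≈⟨ solve 5 (λ o f u v y → (o :+ v) :* f :+ f :* (u :+ y) := (o :+ u) :* f :+ f :* (v :+ y))
                 refl 1# F (ι k) x (- ι k) ⟩
    (1# + ι k) * F + F * (x + - ι k) ∎
    where F = fall x k

  ι-C*!≈fall : ∀ m k → ι ((m C k) *ℕ k !) ≈ fall (ι m) k
  ι-C*!≈fall m zero = begin
    ι ((m C 0) *ℕ 1) ≡⟨ ≡.cong (λ z → ι (z *ℕ 1)) (nC0≡1 m) ⟩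
    1# + 0#          ≈⟨ +-identityʳ _ ⟩
    1#               ∎
  ι-C*!≈fall zero (suc k) = begin
    ι ((0 C suc k) *ℕ suc k !) ≡⟨ ≡.cong (λ z → ι (z *ℕ suc k !)) (k>n⇒nCk≡0 {0} {suc k} (s≤s z≤n)) ⟩
    0#                         ≈⟨ fall-0#-suc k ⟨
    fall 0# (suc k)            ∎
  ι-C*!≈fall (suc m) (suc k) = begin
    ι ((suc m C suc k) *ℕ suc k !)
      ≡⟨ ≡.cong ι ([1+n]C[1+k]*x m k (suc k !)) ⟩
    ι ((m C k) *ℕ (suc k *ℕ k !) +ℕ (m C suc k) *ℕ suc k !)
      ≡⟨ ≡.cong (λ z → ι (z +ℕ (m C suc k) *ℕ suc k !)) (x∙yz≈y∙xz (m C k) (suc k) (k !)) ⟩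
    ι (suc k *ℕ ((m C k) *ℕ k !) +ℕ (m C suc k) *ℕ suc k !)
      ≈⟨ trans (ι-homo-+ (suc k *ℕ ((m C k) *ℕ k !)) _) (+-congʳ (ι-homo-* (suc k) ((m C k) *ℕ k !))) ⟩
    ι (suc k) * ι ((m C k) *ℕ k !) + ι ((m C suc k) *ℕ suc k !)
      ≈⟨ +-cong (*-congˡ (ι-C*!≈fall m k)) (ι-C*!≈fall m (suc k)) ⟩
    ι (suc k) * fall (ι m) k + fall (ι m) (suc k)
      ≈⟨ fall-pascal (ι m) k ⟨
    fall (1# + ι m) (suc k) ∎
    where open CommutativeSemigroupProperties ℕ.*-commutativeSemigroup using (x∙yz≈y∙xz)

  fall-ι-vanishes : ∀ {m k} → m < k → fall (ι m) k ≈ 0#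
  fall-ι-vanishes {m} {k} m<k = begin
    fall (ι m) k       ≈⟨ ι-C*!≈fall m k ⟨
    ι ((m C k) *ℕ k !) ≡⟨ ≡.cong (λ z → ι (z *ℕ k !)) (k>n⇒nCk≡0 m<k) ⟩
    0#                 ∎

  ι-C*!-suc : ∀ m i → ι ((suc m C suc i) *ℕ i !) ≈ fall (ι m) i + ι ((m C suc i) *ℕ i !)
  ι-C*!-suc m i = begin
    ι ((suc m C suc i) *ℕ i !)                  ≡⟨ ≡.cong ι ([1+n]C[1+k]*x m i (i !)) ⟩
    ι ((m C i) *ℕ i ! +ℕ (m C suc i) *ℕ i !)    ≈⟨ ι-homo-+ ((m C i) *ℕ i !) _ ⟩
    ι ((m C i) *ℕ i !) + ι ((m C suc i) *ℕ i !) ≈⟨ +-congʳ (ι-C*!≈fall m i) ⟩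
    fall (ι m) i + ι ((m C suc i) *ℕ i !)       ∎

  genFall-0#-suc : ∀ lam n → genFall lam 0# (suc n) ≈ 0#
  genFall-0#-suc lam zero    =
    trans (*-identityˡ _) (trans (+-identityˡ _) (trans (-‿cong (zeroˡ _)) ε⁻¹≈ε))
  genFall-0#-suc lam (suc n) = trans (*-congʳ (genFall-0#-suc lam n)) (zeroˡ _)

  x*y≈y*[x-z]+z*y : ∀ x y z → x * y ≈ y * (x + - z) + z * y
  x*y≈y*[x-z]+z*y x y z = begin
    x * y                    ≈⟨ *-comm x y ⟩
    y * x                    ≈⟨ +-identityʳ _ ⟨
    y * x + 0#               ≈⟨ +-congˡ (trans (*-congˡ (-‿inverseʳ z)) (zeroʳ y)) ⟨
    y * x + y * (z + - z)
      ≈⟨ solve 4 (λ x y z w → y :* x :+ y :* (z :+ w) := y :* (x :+ w) :+ z :* y) refl x y z (- z) ⟩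
    y * (x + - z) + z * y    ∎

  module DegenerateStirling (lam : Carrier) (S : ℕ → ℕ → Carrier) (isS : IsDegStirling2 lam S) where
    expansion : ∀ n x → genFall lam x n ≈ sumBelow (suc n) (λ k → S n k * fall x k)
    expansion = proj₁ isS

    S-vanishes : ∀ n k → n < k → S n k ≈ 0#
    S-vanishes = proj₂ isS

    S[1+n,0]≈0 : ∀ n → S (suc n) 0 ≈ 0#
    S[1+n,0]≈0 n = begin
      S (suc n) 0                        ≈⟨ trans (+-identityˡ _) (*-identityʳ _) ⟨
      sumBelow 1 g                       ≈⟨ sumBelow-vanishing-tail higher (s≤s z≤n) ⟨
      sumBelow (suc (suc n)) g           ≈⟨ expansion (suc n) 0# ⟨
      genFall lam 0# (suc n)             ≈⟨ genFall-0#-suc lam n ⟩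
      0#                                 ∎
      where
      g = λ k → S (suc n) k * fall 0# k
      higher : ∀ k → 1 ≤ k → g k ≈ 0#
      higher (suc k) _ = trans (*-congˡ (fall-0#-suc k)) (zeroʳ _)

    T : ℕ → ℕ → Carrier
    T α k = S (suc α) k + ι α * lam * S α k

    T-zero : ∀ α → T α 0 ≈ 0#
    T-zero α = trans (+-cong (S[1+n,0]≈0 α) (lower α)) (+-identityʳ _)
      where
      lower : ∀ α → ι α * lam * S α 0 ≈ 0#
      lower zero    = trans (*-congʳ (zeroˡ lam)) (zeroˡ _)
      lower (suc α) = trans (*-congˡ (S[1+n,0]≈0 α)) (zeroʳ _)

    T-vanishes : ∀ α k → suc (suc α) ≤ k → T α k ≈ 0#
    T-vanishes α k α+1<k = trans (+-cong (S-vanishes (suc α) k α+1<k) lower) (+-identityʳ _)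
      where
      lower : ι α * lam * S α k ≈ 0#
      lower = trans (*-congˡ (S-vanishes α k (ℕ.≤-trans (ℕ.n≤1+n _) α+1<k))) (zeroʳ _)

    x*genFall≈ΣT*fall : ∀ α x →
      x * genFall lam x α ≈ sumBelow (suc (suc α)) (λ k → T α k * fall x k)
    x*genFall≈ΣT*fall α x = begin
      x * G
        ≈⟨ x*y≈y*[x-z]+z*y x G αλ ⟩
      genFall lam x (suc α) + αλ * G
        ≈⟨ +-cong (expansion (suc α) x) (*-congˡ (expansion α x)) ⟩
      sumBelow (suc (suc α)) h₁ + αλ * sumBelow (suc α) h₀
        ≈⟨ +-congˡ (sumBelow-*ˡ αλ h₀ (suc α)) ⟨
      sumBelow (suc (suc α)) h₁ + sumBelow (suc α) ch₀
        ≈⟨ +-congˡ (sumBelow-vanishing-tail ch₀-vanishes (ℕ.n≤1+n (suc α))) ⟨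
      sumBelow (suc (suc α)) h₁ + sumBelow (suc (suc α)) ch₀
        ≈⟨ sumBelow-+ h₁ ch₀ (suc (suc α)) ⟨
      sumBelow (suc (suc α)) (λ k → h₁ k + ch₀ k)
        ≈⟨ sumBelow-cong collect (suc (suc α)) ⟩
      sumBelow (suc (suc α)) (λ k → T α k * fall x k) ∎
      where
      G  = genFall lam x α
      αλ = ι α * lam
      h₁ = λ k → S (suc α) k * fall x k
      h₀ = λ k → S α k * fall x k
      ch₀ = λ k → αλ * h₀ k
      ch₀-vanishes : ∀ k → suc α ≤ k → ch₀ k ≈ 0#
      ch₀-vanishes k α<k = trans (*-congˡ (trans (*-congʳ (S-vanishes α k α<k)) (zeroˡ _))) (zeroʳ _)
      collect : ∀ k → h₁ k + ch₀ k ≈ T α k * fall x k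
      collect k = solve 4 (λ s₁ c s₀ f → s₁ :* f :+ c :* (s₀ :* f) := (s₁ :+ c :* s₀) :* f)
                          refl (S (suc α) k) αλ (S α k) (fall x k)

    module _ (torsionFree : (n : ℕ) (a : Carrier) → ι (suc n) * a ≈ 0# → a ≈ 0#) where

      ι-suc-*-cancelˡ : ∀ n {a b} → ι (suc n) * a ≈ ι (suc n) * b → a ≈ b
      ι-suc-*-cancelˡ n {a} {b} eq = x∙y⁻¹≈ε⇒x≈y a b (torsionFree n (a + - b) (begin
        ι (suc n) * (a + - b)             ≈⟨ distribˡ _ _ _ ⟩
        ι (suc n) * a + ι (suc n) * - b   ≈⟨ +-congˡ (-‿distribʳ-* _ _) ⟨
        ι (suc n) * a + - (ι (suc n) * b) ≈⟨ +-congʳ eq ⟩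
        ι (suc n) * b + - (ι (suc n) * b) ≈⟨ -‿inverseʳ _ ⟩
        0#                                ∎))

      genFall-ι-suc : ∀ α m →
        genFall lam (ι (suc m)) α ≈ sumBelow (suc m) (λ i → fall (ι m) i * T α (suc i))
      genFall-ι-suc α m = ι-suc-*-cancelˡ m (begin
        x * genFall lam x α                      ≈⟨ x*genFall≈ΣT*fall α x ⟩
        sumBelow (suc (suc α)) g                 ≈⟨ sumBelow-vanishing-beyond g-vanishesᵀ g-vanishesᶠ ⟩
        sumBelow (suc (suc m)) g                 ≈⟨ sumBelow-suc g (suc m) ⟩
        g 0 + sumBelow (suc m) (λ i → g (suc i)) ≈⟨ +-congʳ (trans (*-identityʳ _) (T-zero α)) ⟩
        0# + sumBelow (suc m) (λ i → g (suc i))  ≈⟨ +-identityˡ _ ⟩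
        sumBelow (suc m) (λ i → g (suc i))       ≈⟨ sumBelow-cong factor (suc m) ⟩
        sumBelow (suc m) (λ i → x * t i)         ≈⟨ sumBelow-*ˡ x t (suc m) ⟩
        x * sumBelow (suc m) t                   ∎)
        where
        x = ι (suc m)
        g = λ k → T α k * fall x k
        t = λ i → fall (ι m) i * T α (suc i)
        g-vanishesᵀ : ∀ k → suc (suc α) ≤ k → g k ≈ 0#
        g-vanishesᵀ k le = trans (*-congʳ (T-vanishes α k le)) (zeroˡ _)
        g-vanishesᶠ : ∀ k → suc (suc m) ≤ k → g k ≈ 0#
        g-vanishesᶠ k le = trans (*-congˡ (fall-ι-vanishes le)) (zeroʳ _)
        factor : ∀ i → g (suc i) ≈ x * t i
        factor i = begin
          T α (suc i) * fall x (suc i)     ≈⟨ *-congˡ (fall-1+ (ι m) i) ⟩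
          T α (suc i) * (x * fall (ι m) i) ≈⟨ x∙yz≈y∙zx (T α (suc i)) x (fall (ι m) i) ⟩
          x * (fall (ι m) i * T α (suc i)) ∎

      sumBelow-genFall : ∀ α m → sumBelow m (λ j → genFall lam (ι (suc j)) α)
                            ≈ sumBelow m (λ i → ι ((m C suc i) *ℕ i !) * T α (suc i))
      sumBelow-genFall α zero    = refl
      sumBelow-genFall α (suc m) = begin
        sumBelow m G + G m                          ≈⟨ +-cong (sumBelow-genFall α m) (genFall-ι-suc α m) ⟩
        sumBelow m (F m) + sumBelow (suc m) t       ≈⟨ +-congʳ (+-identityʳ _) ⟨
        sumBelow m (F m) + 0# + sumBelow (suc m) t  ≈⟨ +-congʳ (+-congˡ last-vanishes) ⟨
        sumBelow (suc m) (F m) + sumBelow (suc m) t ≈⟨ +-comm _ _ ⟩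
        sumBelow (suc m) t + sumBelow (suc m) (F m) ≈⟨ sumBelow-+ t (F m) (suc m) ⟨
        sumBelow (suc m) (λ i → t i + F m i)        ≈⟨ sumBelow-cong pascal (suc m) ⟩
        sumBelow (suc m) (F (suc m))                ∎
        where
        G = λ j → genFall lam (ι (suc j)) α
        F = λ n i → ι ((n C suc i) *ℕ i !) * T α (suc i)
        t = λ i → fall (ι m) i * T α (suc i)
        last-vanishes : F m m ≈ 0#
        last-vanishes =
          trans (*-congʳ (reflexive (≡.cong (λ z → ι (z *ℕ m !)) (k>n⇒nCk≡0 (ℕ.n<1+n m))))) (zeroˡ _)
        pascal : ∀ i → t i + F m i ≈ F (suc m) i
        pascal i = trans (sym (distribʳ _ _ _)) (*-congʳ (sym (ι-C*!-suc m i)))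

theorem3 : {c ℓ : Level} (R : CommutativeRing c ℓ) →
    let open CommutativeRing R
        open RingDefs R
    in
    ((n : ℕ) (a : Carrier) → ι (suc n) * a ≈ 0# → a ≈ 0#) →
    (lam : Carrier) (S : ℕ → ℕ → Carrier) → IsDegStirling2 lam S →
    (α m : ℕ) → 1 ≤ α → α ≤ m →
    sumFromTo α m (λ k → genFall lam (ι k) α)
      ≈ sumFromTo 1 m (λ k → ι ((m C k) *ℕ ((k ∸ 1) !)) * (S (suc α) k + ι α * lam * S α k))
        + - sumFromTo 1 (α ∸ 1) (λ k → ι (((α ∸ 1) C k) *ℕ ((k ∸ 1) !)) * (S (suc α) k + ι α * lam * S α k))
theorem3 R torsionFree lam S isS α@(suc a) m _ α≤m = begin
  sumBelow (m ∸ a) (λ i → G (a +ℕ i))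
    ≈⟨ sumBelow-∸ R G (ℕ.<⇒≤ α≤m) ⟩
  sumBelow m G + - sumBelow a G
    ≈⟨ +-cong (sumBelow-genFall torsionFree α m) (-‿cong (sumBelow-genFall torsionFree α a)) ⟩
  sumBelow m (F m) + - sumBelow a (F a) ∎
  where
  open CommutativeRing R
  open RingDefs R
  open import Relation.Binary.Reasoning.Setoid setoid
  open DegenerateStirling R lam S isS
  G = λ j → genFall lam (ι (suc j)) α
  F = λ n i → ι ((n C suc i) *ℕ i !) * T α (suc i)
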